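{- $a_{3, 2}\le \frac{1}{\sqrt{2}}$.
   Context: Let $H_{n,3}=\{0,1,\dots,n-1\}^3$. A $2$-rook is a point $P\in H_{n,3}$ together with a set $D$ of $2$ of the $3$ coordinate indices; it covers $P$ itself and every point of $H_{n,3}$ which differs from $P$ in exactly one coordinate, that coordinate belonging to $D$. Distinct rooks must occupy distinct points. $a_{n,3,2}$ is the minimum number of $2$-rooks whose covered sets together cover $H_{n,3}$, and $a_{3,2}=\lim_{n\to\infty} a_{n,3,2}/n^{2}$ (this limit exists). -}

module Defs where

open import Data.Nat using (ℕ; _*_; _≤_; _<_; _≥_)
open import Data.Fin using (Fin)
open import Data.Fin.Subset using (Subset; _∈_; ∣_∣)
open import Data.Vec using (Vec; lookup)
open import Data.List using (List; map; length)
open import Data.List.Relation.Unary.Unique.Propositional using (Unique)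
open import Data.List.Relation.Unary.Any using (Any)
open import Data.Product using (Σ; ∃; _×_; _,_; proj₁)
open import Data.Sum using (_⊎_)
open import Relation.Binary.PropositionalEquality using (_≡_; _≢_)

Point : ℕ → Set
Point n = Vec (Fin n) 3

record Rook (n : ℕ) : Set where
  constructor rook
  field
    pos  : Point n
    dirs : Subset 3
    two  : ∣ dirs ∣ ≡ 2
open Rook public

DiffersExactlyAt : ∀ {n} → Point n → Point n → Fin 3 → Set
DiffersExactlyAt P Q i = lookup Q i ≢ lookup P i × (∀ j → j ≢ i → lookup Q j ≡ lookup P j)

Covers : ∀ {n} → Rook n → Point n → Set
Covers r Q = Q ≡ pos r ⊎ (∃ λ i → i ∈ dirs r × DiffersExactlyAt (pos r) Q i)

IsCovering : (n : ℕ) → List (Rook n) → Set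
IsCovering n rs = Unique (map pos rs) × (∀ (Q : Point n) → Any (λ r → Covers r Q) rs)

-- a_{n,3,2} ≤ k  (a_{n,3,2} is the minimum size of a covering).
aLe : ℕ → ℕ → Set
aLe n k = Σ (List (Rook n)) λ rs → IsCovering n rs × length rs ≤ k

module Submission where

-- Let m = n − s and h = ⌊n/2⌋.  For each cell (i, j) of an s × h grid put a rook at
-- (m + i, v, j), and for each cell of an s × (n − h) grid one at (v, m + i, h + j):
-- s·n rooks.  A rook moves along y in the lower slab z < h and along x in the upper
-- one, and in addition along z if its cell is a row cell, along its third axis if it
-- is a column cell.  All points are covered once the values v < m form a pattern:
-- every row shows every value in its row cells and every column every value in its
-- column cells.  On an s × c grid write (i c + j s) mod s c both as t s + (i c mod s)
-- and as u c + (j s mod c); along a row t takes every value mod c, along a column u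
-- every value mod s.  Cells with t < m become row cells with value t, the others
-- column cells with value u − (s − m); when m (s + c) ≤ s c every u ≥ s − m indeed
-- lands in a column cell.  That inequality holds for c ≈ n/2 once n² + n ≤ 2 s², and
-- s = ⌊a n / (b + 1)⌋ < n satisfies this for large n because (b + 1)² < 2 a².

open import Defs
open import Data.Nat using (ℕ; zero; suc; NonZero; >-nonZero; _+_; _*_; _∸_; _/_; _%_;
  _≤_; _<_; _≥_; _≤?_; _<?_; z≤n; s≤s; ⌊_/2⌋; ⌈_/2⌉)
open import Data.Nat.Properties
open import Data.Nat.DivMod
open import Data.Nat.Divisibility using (n∣m*n)
open import Data.Nat.Tactic.RingSolver using (solve)
open import Data.List using () renaming (_∷_ to _∷ₗ_; [] to []ₗ)
open import Data.Fin using (Fin; zero; suc; toℕ; fromℕ<; cast; _↑ˡ_; _↑ʳ_; splitAt) renaming (_≟_ to _≟ᶠ_)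
open import Data.Fin.Properties using (toℕ-injective; toℕ<n; toℕ-fromℕ<; toℕ-cast; toℕ-↑ˡ; toℕ-↑ʳ;
  splitAt⁻¹-↑ˡ; splitAt⁻¹-↑ʳ; cast-involutive)
open import Data.Fin.Subset using (Subset; inside; outside; ∣_∣) renaming (_∈_ to _∈ₛ_)
open import Data.Vec using (_∷_; []; lookup; here; there)
open import Data.Vec.Relation.Binary.Pointwise.Extensional using (ext; Pointwise-≡⇒≡)
open import Data.List using (List; map; length; _++_; cartesianProductWith; allFin)
open import Data.List.Properties using (map-++; map-∘; length-++; length-map; length-tabulate)
open import Data.List.Relation.Unary.Any using (Any)
open import Data.List.Relation.Unary.Unique.Propositional using (Unique)
import Data.List.Relation.Unary.Unique.Propositional.Properties as Unique
open import Data.List.Membership.Propositional using (_∈_; lose)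
open import Data.List.Membership.Propositional.Properties
  using (∈-allFin; ∈-cartesianProductWith⁺; ∈-cartesianProductWith⁻; ∈-++⁺ˡ; ∈-++⁺ʳ)
open import Data.Product using (Σ; ∃; _×_; _,_; proj₂)
open import Data.Sum using (inj₁; inj₂)
open import Data.Empty using (⊥-elim)
open import Function using (id)
open import Relation.Nullary using (¬_; yes; no; contradiction)
open import Relation.Binary.PropositionalEquality

map-cartesianProductWith : ∀ {A B C D : Set} (g : C → D) (f : A → B → C) xs ys →
  map g (cartesianProductWith f xs ys) ≡ cartesianProductWith (λ x y → g (f x y)) xs ys
map-cartesianProductWith g f List.[] ys = refl
map-cartesianProductWith g f (x List.∷ xs) ys = begin
  map g (map (f x) ys ++ cartesianProductWith f xs ys)
    ≡⟨ map-++ g (map (f x) ys) _ ⟩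
  map g (map (f x) ys) ++ map g (cartesianProductWith f xs ys)
    ≡⟨ cong₂ _++_ (sym (map-∘ ys)) (map-cartesianProductWith g f xs ys) ⟩
  map (λ y → g (f x y)) ys ++ cartesianProductWith (λ x y → g (f x y)) xs ys ∎
  where open ≡-Reasoning

length-cartesianProductWith : ∀ {A B C : Set} (f : A → B → C) xs ys →
  length (cartesianProductWith f xs ys) ≡ length xs * length ys
length-cartesianProductWith f List.[] ys = refl
length-cartesianProductWith f (x List.∷ xs) ys = begin
  length (map (f x) ys ++ cartesianProductWith f xs ys)
    ≡⟨ length-++ (map (f x) ys) ⟩
  length (map (f x) ys) + length (cartesianProductWith f xs ys)
    ≡⟨ cong₂ _+_ (length-map (f x) ys) (length-cartesianProductWith f xs ys) ⟩
  length ys + length xs * length ys ∎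
  where open ≡-Reasoning

%-shift-surjective : ∀ c .{{_ : NonZero c}} q v → v < c → ∃ λ (j : Fin c) → (q + toℕ j) % c ≡ v
%-shift-surjective (suc c) q v v<c = (v + c * q) mod suc c , (begin
  (q + toℕ ((v + c * q) mod suc c)) % suc c      ≡⟨ cong (λ t → (q + t) % suc c) (toℕ-fromℕ< _) ⟩
  (q + (v + c * q) % suc c) % suc c              ≡⟨ %-distribˡ-+ q _ (suc c) ⟩
  (q % suc c + (v + c * q) % suc c % suc c) % suc c
    ≡⟨ cong (λ t → (q % suc c + t) % suc c) (m%n%n≡m%n (v + c * q) (suc c)) ⟩
  (q % suc c + (v + c * q) % suc c) % suc c      ≡⟨ %-distribˡ-+ q (v + c * q) (suc c) ⟨
  (q + (v + c * q)) % suc c                      ≡⟨ %-congˡ regroup ⟩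
  (v + q * suc c) % suc c                        ≡⟨ [m+kn]%n≡m%n v q (suc c) ⟩
  v % suc c                                      ≡⟨ m<n⇒m%n≡m v<c ⟩
  v                                              ∎)
  where
  open ≡-Reasoning
  regroup : q + (v + c * q) ≡ v + q * suc c
  regroup = solve (q ∷ₗ v ∷ₗ c ∷ₗ []ₗ)

m%[n*o]≡o*[m/o%n]+m%o : ∀ m n o .{{_ : NonZero n}} .{{_ : NonZero o}} {{_ : NonZero (n * o)}} →
  m % (n * o) ≡ o * (m / o % n) + m % o
m%[n*o]≡o*[m/o%n]+m%o m n o = begin
  m % (n * o)                           ≡⟨ m≡m%n+[m/n]*n (m % (n * o)) o ⟩
  m % (n * o) % o + m % (n * o) / o * o ≡⟨ cong₂ _+_ (m∣n⇒o%n%m≡o%m o (n * o) m (n∣m*n n))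
                                                      (cong (_* o) (m%[n*o]/o≡m/o%n m n o)) ⟩
  m % o + m / o % n * o                 ≡⟨ +-comm (m % o) _ ⟩
  m / o % n * o + m % o                 ≡⟨ cong (_+ m % o) (*-comm (m / o % n) o) ⟩
  o * (m / o % n) + m % o               ∎
  where open ≡-Reasoning

[m+k*o]%[n*o]≡o*[[m/o+k]%n]+m%o : ∀ m k n o .{{_ : NonZero n}} .{{_ : NonZero o}} {{_ : NonZero (n * o)}} →
  (m + k * o) % (n * o) ≡ o * ((m / o + k) % n) + m % o
[m+k*o]%[n*o]≡o*[[m/o+k]%n]+m%o m k n o = begin
  (m + k * o) % (n * o)                           ≡⟨ m%[n*o]≡o*[m/o%n]+m%o (m + k * o) n o ⟩
  o * ((m + k * o) / o % n) + (m + k * o) % o     ≡⟨ cong₂ (λ x y → o * (x % n) + y) quotient remainder ⟩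
  o * ((m / o + k) % n) + m % o                   ∎
  where
  open ≡-Reasoning
  quotient : (m + k * o) / o ≡ m / o + k
  quotient = trans (+-distrib-/-∣ʳ m (n∣m*n k)) (cong (m / o +_) (m*n/n≡m k o))
  remainder : (m + k * o) % o ≡ m % o
  remainder = %-remove-+ʳ m (n∣m*n k)

m<n*[1+m/n] : ∀ m n .{{_ : NonZero n}} → m < n * suc (m / n)
m<n*[1+m/n] m n = begin-strict
  m                 ≡⟨ m≡m%n+[m/n]*n m n ⟩
  m % n + m / n * n <⟨ +-monoˡ-< (m / n * n) (m%n<n m n) ⟩
  n + m / n * n     ≡⟨ cong (n +_) (*-comm (m / n) n) ⟩
  n + n * (m / n)   ≡⟨ *-suc n (m / n) ⟨
  n * suc (m / n)   ∎
  where open ≤-Reasoning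

n*[m/n]≤m : ∀ m n .{{_ : NonZero n}} → n * (m / n) ≤ m
n*[m/n]≤m m n = subst (_≤ m) (*-comm (m / n) n) (m/n*n≤m m n)

module Halves {n} (l r : ℕ) (l+r≡n : l + r ≡ n) where

  low : Fin l → Fin n
  low v = cast l+r≡n (v ↑ˡ r)

  high : Fin r → Fin n
  high i = cast l+r≡n (l ↑ʳ i)

  toℕ-low : ∀ v → toℕ (low v) ≡ toℕ v
  toℕ-low v = trans (toℕ-cast l+r≡n (v ↑ˡ r)) (toℕ-↑ˡ v r)

  toℕ-high : ∀ i → toℕ (high i) ≡ l + toℕ i
  toℕ-high i = trans (toℕ-cast l+r≡n (l ↑ʳ i)) (toℕ-↑ʳ l i)

  low-injective : ∀ {v w} → low v ≡ low w → v ≡ w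
  low-injective {v} {w} eq = toℕ-injective (begin
    toℕ v       ≡⟨ sym (toℕ-low v) ⟩
    toℕ (low v) ≡⟨ cong toℕ eq ⟩
    toℕ (low w) ≡⟨ toℕ-low w ⟩
    toℕ w       ∎)
    where open ≡-Reasoning

  high-injective : ∀ {i j} → high i ≡ high j → i ≡ j
  high-injective {i} {j} eq = toℕ-injective (+-cancelˡ-≡ l (toℕ i) (toℕ j) (begin
    l + toℕ i    ≡⟨ sym (toℕ-high i) ⟩
    toℕ (high i) ≡⟨ cong toℕ eq ⟩
    toℕ (high j) ≡⟨ toℕ-high j ⟩
    l + toℕ j    ∎))
    where open ≡-Reasoning

  low≢high : ∀ v i → low v ≢ high i
  low≢high v i eq = <⇒≱ (toℕ<n v) (begin
    l            ≤⟨ m≤m+n l (toℕ i) ⟩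
    l + toℕ i    ≡⟨ toℕ-high i ⟨
    toℕ (high i) ≡⟨ cong toℕ eq ⟨
    toℕ (low v)  ≡⟨ toℕ-low v ⟩
    toℕ v        ∎)
    where open ≤-Reasoning

  data View : Fin n → Set where
    is-low  : ∀ v → View (low v)
    is-high : ∀ i → View (high i)

  uncast : ∀ {p q} → p ≡ cast (sym l+r≡n) q → cast l+r≡n p ≡ q
  uncast {q = q} refl = cast-involutive l+r≡n (sym l+r≡n) q

  view : ∀ q → View q
  view q with splitAt l (cast (sym l+r≡n) q) in split≡
  ... | inj₁ v = subst View (uncast (splitAt⁻¹-↑ˡ split≡)) (is-low v)
  ... | inj₂ i = subst View (uncast (splitAt⁻¹-↑ʳ split≡)) (is-high i)

covers-along : ∀ {n} (r : Rook n) {Q} k → k ∈ₛ dirs r →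
  (∀ l → l ≢ k → lookup Q l ≡ lookup (pos r) l) → Covers r Q
covers-along r {Q} k k∈D agree with lookup Q k ≟ᶠ lookup (pos r) k
... | no differ = inj₂ (k , k∈D , differ , agree)
... | yes same = inj₁ (Pointwise-≡⇒≡ (ext agree-everywhere))
  where
  agree-everywhere : ∀ l → lookup Q l ≡ lookup (pos r) l
  agree-everywhere l with l ≟ᶠ k
  ... | yes refl = same
  ... | no l≢k = agree l l≢k

data Kind : Set where
  row column : Kind

record Pattern (s c m : ℕ) : Set where
  field
    cell        : Fin s → Fin c → Kind × Fin m
    row-onto    : ∀ i v → ∃ λ j → cell i j ≡ (row , v)
    column-onto : ∀ j v → ∃ λ i → cell i j ≡ (column , v)

module CyclicPattern (s c m : ℕ) .{{_ : NonZero s}} .{{_ : NonZero c}} .{{_ : NonZero m}}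
                     (balanced : m * (s + c) ≤ s * c) where

  instance
    s*c≢0 : NonZero (s * c)
    s*c≢0 = m*n≢0 s c
    c*s≢0 : NonZero (c * s)
    c*s≢0 = m*n≢0 c s

  t u : ℕ → ℕ → ℕ
  t i j = (i * c / s + j) % c
  u i j = (j * s / c + i) % s

  -- Both sides are (i c + j s) mod s c.
  digits-agree : ∀ i j → s * t i j + i * c % s ≡ c * u i j + j * s % c
  digits-agree i j = begin
    s * t i j + i * c % s      ≡⟨ [m+k*o]%[n*o]≡o*[[m/o+k]%n]+m%o (i * c) j c s ⟨
    (i * c + j * s) % (c * s)  ≡⟨ %-congʳ (*-comm c s) ⟩
    (i * c + j * s) % (s * c)  ≡⟨ %-congˡ {o = s * c} (+-comm (i * c) (j * s)) ⟩
    (j * s + i * c) % (s * c)  ≡⟨ [m+k*o]%[n*o]≡o*[[m/o+k]%n]+m%o (j * s) i s c ⟩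
    c * u i j + j * s % c      ∎
    where open ≡-Reasoning

  m≤c : m ≤ c
  m≤c = *-cancelʳ-≤ m c s (begin
    m * s       ≤⟨ *-monoʳ-≤ m (m≤m+n s c) ⟩
    m * (s + c) ≤⟨ balanced ⟩
    s * c       ≡⟨ *-comm s c ⟩
    c * s       ∎)
    where open ≤-Reasoning

  m≤s : m ≤ s
  m≤s = *-cancelʳ-≤ m s c (begin
    m * c       ≤⟨ *-monoʳ-≤ m (m≤n+m c s) ⟩
    m * (s + c) ≤⟨ balanced ⟩
    s * c       ∎)
    where open ≤-Reasoning

  m*s≤[s∸m]*c : m * s ≤ (s ∸ m) * c
  m*s≤[s∸m]*c = +-cancelʳ-≤ (m * c) (m * s) ((s ∸ m) * c) (begin
    m * s + m * c       ≡⟨ *-distribˡ-+ m s c ⟨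
    m * (s + c)         ≤⟨ balanced ⟩
    s * c               ≡⟨ cong (_* c) (m∸n+n≡m m≤s) ⟨
    (s ∸ m + m) * c     ≡⟨ *-distribʳ-+ c (s ∸ m) m ⟩
    (s ∸ m) * c + m * c ∎)
    where open ≤-Reasoning

  row-part< : ∀ i j → t i j < m → s * t i j + i * c % s < m * s
  row-part< i j t<m = begin-strict
    s * t i j + i * c % s ≡⟨ +-comm (s * t i j) _ ⟩
    i * c % s + s * t i j <⟨ +-monoˡ-< (s * t i j) (m%n<n (i * c) s) ⟩
    s + s * t i j         ≡⟨ *-suc s (t i j) ⟨
    s * suc (t i j)       ≤⟨ *-monoʳ-≤ s t<m ⟩
    s * m                 ≡⟨ *-comm s m ⟩
    m * s                 ∎
    where open ≤-Reasoning

  column-part≥ : ∀ i j → s ∸ m ≤ u i j → m * s ≤ c * u i j + j * s % c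
  column-part≥ i j s∸m≤u = begin
    m * s                 ≤⟨ m*s≤[s∸m]*c ⟩
    (s ∸ m) * c           ≡⟨ *-comm (s ∸ m) c ⟩
    c * (s ∸ m)           ≤⟨ *-monoʳ-≤ c s∸m≤u ⟩
    c * u i j             ≤⟨ m≤m+n (c * u i j) _ ⟩
    c * u i j + j * s % c ∎
    where open ≤-Reasoning

  u∸[s∸m]<m : ∀ i j → u i j ∸ (s ∸ m) < m
  u∸[s∸m]<m i j = m<n+o⇒m∸n<o (u i j) (s ∸ m)
    (subst (u i j <_) (sym (m∸n+n≡m m≤s)) (m%n<n (j * s / c + i) s))

  cell : Fin s → Fin c → Kind × Fin m
  cell i j with t (toℕ i) (toℕ j) <? m
  ... | yes t<m = row , fromℕ< t<m
  ... | no _    = column , fromℕ< (u∸[s∸m]<m (toℕ i) (toℕ j))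

  cell-row : ∀ i j (t<m : t (toℕ i) (toℕ j) < m) → cell i j ≡ (row , fromℕ< t<m)
  cell-row i j t<m with t (toℕ i) (toℕ j) <? m
  ... | yes _  = refl
  ... | no t≮m = contradiction t<m t≮m

  cell-column : ∀ i j → ¬ t (toℕ i) (toℕ j) < m →
                cell i j ≡ (column , fromℕ< (u∸[s∸m]<m (toℕ i) (toℕ j)))
  cell-column i j t≮m with t (toℕ i) (toℕ j) <? m
  ... | yes t<m = contradiction t<m t≮m
  ... | no _    = refl

  row-onto : ∀ i v → ∃ λ j → cell i j ≡ (row , v)
  row-onto i v with %-shift-surjective c (toℕ i * c / s) (toℕ v) (<-≤-trans (toℕ<n v) m≤c)
  ... | j , t≡v = j , trans (cell-row i j t<m) (cong (row ,_) (toℕ-injective (trans (toℕ-fromℕ< t<m) t≡v)))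
    where
    t<m : t (toℕ i) (toℕ j) < m
    t<m = subst (_< m) (sym t≡v) (toℕ<n v)

  s∸m+v<s : ∀ (v : Fin m) → s ∸ m + toℕ v < s
  s∸m+v<s v = subst (s ∸ m + toℕ v <_) (m∸n+n≡m m≤s) (+-monoʳ-< (s ∸ m) (toℕ<n v))

  column-onto : ∀ j v → ∃ λ i → cell i j ≡ (column , v)
  column-onto j v with %-shift-surjective s (toℕ j * s / c) (s ∸ m + toℕ v) (s∸m+v<s v)
  ... | i , u≡w = i , trans (cell-column i j t≮m) (cong (column ,_) (toℕ-injective value≡v))
    where
    open ≡-Reasoning
    t≮m : ¬ t (toℕ i) (toℕ j) < m
    t≮m t<m = <⇒≱ (row-part< (toℕ i) (toℕ j) t<m)
      (subst (m * s ≤_) (sym (digits-agree (toℕ i) (toℕ j)))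
        (column-part≥ (toℕ i) (toℕ j) (subst (s ∸ m ≤_) (sym u≡w) (m≤m+n (s ∸ m) (toℕ v)))))
    value≡v : toℕ (fromℕ< (u∸[s∸m]<m (toℕ i) (toℕ j))) ≡ toℕ v
    value≡v = begin
      toℕ (fromℕ< (u∸[s∸m]<m (toℕ i) (toℕ j))) ≡⟨ toℕ-fromℕ< (u∸[s∸m]<m (toℕ i) (toℕ j)) ⟩
      u (toℕ i) (toℕ j) ∸ (s ∸ m)              ≡⟨ cong (_∸ (s ∸ m)) u≡w ⟩
      s ∸ m + toℕ v ∸ (s ∸ m)                  ≡⟨ m+n∸m≡n (s ∸ m) (toℕ v) ⟩
      toℕ v                                    ∎

  cyclic-pattern : Pattern s c m
  cyclic-pattern = record { cell = cell ; row-onto = row-onto ; column-onto = column-onto }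

along-x : ∀ {n} (r : Rook n) {x y z} → zero ∈ₛ dirs r →
  y ≡ lookup (pos r) (suc zero) → z ≡ lookup (pos r) (suc (suc zero)) → Covers r (x ∷ y ∷ z ∷ [])
along-x r x∈D y≡ z≡ = covers-along r zero x∈D λ
  { zero l≢x → ⊥-elim (l≢x refl) ; (suc zero) _ → y≡ ; (suc (suc zero)) _ → z≡ }

along-y : ∀ {n} (r : Rook n) {x y z} → suc zero ∈ₛ dirs r →
  x ≡ lookup (pos r) zero → z ≡ lookup (pos r) (suc (suc zero)) → Covers r (x ∷ y ∷ z ∷ [])
along-y r y∈D x≡ z≡ = covers-along r (suc zero) y∈D λ
  { zero _ → x≡ ; (suc zero) l≢y → ⊥-elim (l≢y refl) ; (suc (suc zero)) _ → z≡ }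

along-z : ∀ {n} (r : Rook n) {x y z} → suc (suc zero) ∈ₛ dirs r →
  x ≡ lookup (pos r) zero → y ≡ lookup (pos r) (suc zero) → Covers r (x ∷ y ∷ z ∷ [])
along-z r z∈D x≡ y≡ = covers-along r (suc (suc zero)) z∈D λ
  { zero _ → x≡ ; (suc zero) _ → y≡ ; (suc (suc zero)) l≢z → ⊥-elim (l≢z refl) }

xy xz yz : Subset 3
xy = inside ∷ inside ∷ outside ∷ []
xz = inside ∷ outside ∷ inside ∷ []
yz = outside ∷ inside ∷ inside ∷ []

lowerDirs upperDirs : Kind → Subset 3
lowerDirs row    = yz
lowerDirs column = xy
upperDirs row    = xz
upperDirs column = xy

∣lowerDirs∣≡2 : ∀ k → ∣ lowerDirs k ∣ ≡ 2
∣lowerDirs∣≡2 row    = refl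
∣lowerDirs∣≡2 column = refl

∣upperDirs∣≡2 : ∀ k → ∣ upperDirs k ∣ ≡ 2
∣upperDirs∣≡2 row    = refl
∣upperDirs∣≡2 column = refl

y∈lowerDirs : ∀ k → suc zero ∈ₛ lowerDirs k
y∈lowerDirs row    = there here
y∈lowerDirs column = there here

x∈upperDirs : ∀ k → zero ∈ₛ upperDirs k
x∈upperDirs row    = here
x∈upperDirs column = here

module Construction {n} (m s c₁ c₂ : ℕ) (m+s≡n : m + s ≡ n) (c₁+c₂≡n : c₁ + c₂ ≡ n)
                    (lowerPattern : Pattern s c₁ m) (upperPattern : Pattern s c₂ m) where

  module H = Halves m s m+s≡n
  module V = Halves c₁ c₂ c₁+c₂≡n
  module L = Pattern lowerPattern
  module U = Pattern upperPattern

  lowerPos : Fin s → Fin c₁ → Fin m → Point n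
  lowerPos i j v = H.high i ∷ H.low v ∷ V.low j ∷ []

  upperPos : Fin s → Fin c₂ → Fin m → Point n
  upperPos i j v = H.low v ∷ H.high i ∷ V.high j ∷ []

  lowerRook : Fin s → Fin c₁ → Kind × Fin m → Rook n
  lowerRook i j (k , v) = rook (lowerPos i j v) (lowerDirs k) (∣lowerDirs∣≡2 k)

  upperRook : Fin s → Fin c₂ → Kind × Fin m → Rook n
  upperRook i j (k , v) = rook (upperPos i j v) (upperDirs k) (∣upperDirs∣≡2 k)

  lowerRooks upperRooks rooks : List (Rook n)
  lowerRooks = cartesianProductWith (λ i j → lowerRook i j (L.cell i j)) (allFin s) (allFin c₁)
  upperRooks = cartesianProductWith (λ i j → upperRook i j (U.cell i j)) (allFin s) (allFin c₂)
  rooks = lowerRooks ++ upperRooks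

  lower-covers : ∀ {Q} i j {cell} → L.cell i j ≡ cell → Covers (lowerRook i j cell) Q →
                 Any (λ r → Covers r Q) rooks
  lower-covers i j refl = lose (∈-++⁺ˡ (∈-cartesianProductWith⁺ _ (∈-allFin i) (∈-allFin j)))

  upper-covers : ∀ {Q} i j {cell} → U.cell i j ≡ cell → Covers (upperRook i j cell) Q →
                 Any (λ r → Covers r Q) rooks
  upper-covers i j refl = lose (∈-++⁺ʳ lowerRooks (∈-cartesianProductWith⁺ _ (∈-allFin i) (∈-allFin j)))

  covered : ∀ Q → Any (λ r → Covers r Q) rooks
  covered (x ∷ y ∷ z ∷ []) with V.view z | H.view y | H.view x
  ... | V.is-low j | H.is-low u | _ with L.column-onto j u
  ...   | i , cell≡ = lower-covers i j cell≡ (along-x (lowerRook i j (column , u)) here refl refl)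
  covered _ | V.is-low j | H.is-high _ | H.is-high i =
    lower-covers i j refl (along-y (lowerRook i j _) (y∈lowerDirs _) refl refl)
  covered _ | V.is-low _ | H.is-high i | H.is-low v with U.row-onto i v
  ...   | j , cell≡ = upper-covers i j cell≡ (along-z (upperRook i j (row , v)) (there (there here)) refl refl)
  covered _ | V.is-high j | H.is-high i | _ =
    upper-covers i j refl (along-x (upperRook i j _) (x∈upperDirs _) refl refl)
  covered _ | V.is-high j | H.is-low _ | H.is-low v with U.column-onto j v
  ...   | i , cell≡ = upper-covers i j cell≡ (along-y (upperRook i j (column , v)) (there here) refl refl)
  covered _ | V.is-high _ | H.is-low u | H.is-high i with L.row-onto i u
  ...   | j , cell≡ = lower-covers i j cell≡ (along-z (lowerRook i j (row , u)) (there (there here)) refl refl)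

  lowerPositions upperPositions : List (Point n)
  lowerPositions = cartesianProductWith (λ i j → lowerPos i j (proj₂ (L.cell i j))) (allFin s) (allFin c₁)
  upperPositions = cartesianProductWith (λ i j → upperPos i j (proj₂ (U.cell i j))) (allFin s) (allFin c₂)

  map-pos-rooks : map pos rooks ≡ lowerPositions ++ upperPositions
  map-pos-rooks = trans (map-++ pos lowerRooks upperRooks)
    (cong₂ _++_ (map-cartesianProductWith pos _ (allFin s) (allFin c₁))
                (map-cartesianProductWith pos _ (allFin s) (allFin c₂)))

  x-coordinate y-coordinate z-coordinate : Point n → Fin n
  x-coordinate p = lookup p zero
  y-coordinate p = lookup p (suc zero)
  z-coordinate p = lookup p (suc (suc zero))

  lowerPos-injective : ∀ {i i′ j j′} → lowerPos i j (proj₂ (L.cell i j)) ≡ lowerPos i′ j′ (proj₂ (L.cell i′ j′)) →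
                       i ≡ i′ × j ≡ j′
  lowerPos-injective eq = H.high-injective (cong x-coordinate eq) , V.low-injective (cong z-coordinate eq)

  upperPos-injective : ∀ {i i′ j j′} → upperPos i j (proj₂ (U.cell i j)) ≡ upperPos i′ j′ (proj₂ (U.cell i′ j′)) →
                       i ≡ i′ × j ≡ j′
  upperPos-injective eq = H.high-injective (cong y-coordinate eq) , V.high-injective (cong z-coordinate eq)

  lower∩upper≡∅ : ∀ {p} → ¬ (p ∈ lowerPositions × p ∈ upperPositions)
  lower∩upper≡∅ (p∈lower , p∈upper)
    with ∈-cartesianProductWith⁻ (λ i j → lowerPos i j (proj₂ (L.cell i j))) (allFin s) (allFin c₁) p∈lower
       | ∈-cartesianProductWith⁻ (λ i j → upperPos i j (proj₂ (U.cell i j))) (allFin s) (allFin c₂) p∈upper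
  ... | _ , j , _ , _ , refl | _ , j′ , _ , _ , eq = V.low≢high j j′ (cong z-coordinate eq)

  distinct : Unique (map pos rooks)
  distinct = subst Unique (sym map-pos-rooks) (Unique.++⁺
    (Unique.cartesianProductWith⁺ _ lowerPos-injective (Unique.allFin⁺ s) (Unique.allFin⁺ c₁))
    (Unique.cartesianProductWith⁺ _ upperPos-injective (Unique.allFin⁺ s) (Unique.allFin⁺ c₂))
    lower∩upper≡∅)

  length-rooks : length rooks ≡ s * n
  length-rooks = begin
    length rooks                                   ≡⟨ length-++ lowerRooks ⟩
    length lowerRooks + length upperRooks          ≡⟨ cong₂ _+_ (count _) (count _) ⟩
    s * c₁ + s * c₂                                ≡⟨ *-distribˡ-+ s c₁ c₂ ⟨
    s * (c₁ + c₂)                                  ≡⟨ cong (s *_) c₁+c₂≡n ⟩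
    s * n                                          ∎
    where
    open ≡-Reasoning
    count : ∀ {c} {A : Set} (f : Fin s → Fin c → A) →
            length (cartesianProductWith f (allFin s) (allFin c)) ≡ s * c
    count {c} f = trans (length-cartesianProductWith f (allFin s) (allFin c))
                        (cong₂ _*_ (length-tabulate {n = s} id) (length-tabulate {n = c} id))

  covering : aLe n (s * n)
  covering = rooks , (distinct , covered) , ≤-reflexive length-rooks

square⇒m≤s : ∀ m s → (m + s) * (m + s) + (m + s) ≤ 2 * (s * s) → m ≤ s
square⇒m≤s m s square = ≮⇒≥ λ s<m → <⇒≱ (begin-strict
  2 * (s * s)                 ≡⟨ solve (s ∷ₗ []ₗ) ⟩
  s * s + s * s               ≤⟨ +-monoˡ-≤ (s * s) (*-mono-≤ (<⇒≤ s<m) (<⇒≤ s<m)) ⟩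
  m * m + s * s               ≤⟨ m≤m+n (m * m + s * s) (2 * (m * s)) ⟩
  m * m + s * s + 2 * (m * s) ≡⟨ solve (m ∷ₗ s ∷ₗ []ₗ) ⟩
  (m + s) * (m + s)           <⟨ m<m+n _ (<-≤-trans (≤-<-trans z≤n s<m) (m≤m+n m s)) ⟩
  (m + s) * (m + s) + (m + s) ∎) square
  where open ≤-Reasoning

square⇒balanced : ∀ {n m s c} → m + s ≡ n → n * n + n ≤ 2 * (s * s) → n ≤ suc (2 * c) →
                 m * (s + c) ≤ s * c
square⇒balanced {m = m} {s} {c} refl square n≤1+2c with m≤n⇒∃[o]m+o≡n (square⇒m≤s m s square)
... | d , refl = *-cancelˡ-≤ 2 (+-cancelˡ-≤ d _ _ (begin
  d + 2 * (m * (m + d + c))                          ≤⟨ m≤m+n _ (2 * m) ⟩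
  d + 2 * (m * (m + d + c)) + 2 * m                  ≡⟨ solve (m ∷ₗ d ∷ₗ c ∷ₗ []ₗ) ⟩
  2 * m * c + 2 * m * d + (2 * (m * m) + 2 * m + d)  ≤⟨ +-monoʳ-≤ (2 * m * c + 2 * m * d) d*d-bound ⟩
  2 * m * c + 2 * m * d + d * d                      ≡⟨ solve (m ∷ₗ d ∷ₗ c ∷ₗ []ₗ) ⟩
  2 * m * c + (m + (m + d)) * d                      ≤⟨ +-monoʳ-≤ (2 * m * c) (*-monoˡ-≤ d n≤1+2c) ⟩
  2 * m * c + suc (2 * c) * d                        ≡⟨ solve (m ∷ₗ d ∷ₗ c ∷ₗ []ₗ) ⟩
  d + 2 * ((m + d) * c)                              ∎))
  where
  open ≤-Reasoning
  d*d-bound : 2 * (m * m) + 2 * m + d ≤ d * d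
  d*d-bound = +-cancelˡ-≤ (2 * (m * m) + 4 * (m * d) + d * d) _ _ (begin
    2 * (m * m) + 4 * (m * d) + d * d + (2 * (m * m) + 2 * m + d) ≡⟨ solve (m ∷ₗ d ∷ₗ []ₗ) ⟩
    (m + (m + d)) * (m + (m + d)) + (m + (m + d))                 ≤⟨ square ⟩
    2 * ((m + d) * (m + d))                                       ≡⟨ solve (m ∷ₗ d ∷ₗ []ₗ) ⟩
    2 * (m * m) + 4 * (m * d) + d * d + d * d                     ∎)

-- (c² + 1) n² ≤ 2 (a n)² ≤ 2 c² (s + 1)², and n ≥ 7 c² absorbs the terms of lower order.
n*n+n≤2*[s*s] : ∀ a c n s .{{_ : NonZero c}} .{{_ : NonZero n}} →
                c * c < 2 * (a * a) → 7 * (c * c) ≤ n → s ≤ n → a * n < c * suc s →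
                n * n + n ≤ 2 * (s * s)
n*n+n≤2*[s*s] a c n s c*c<2*a*a 7*c*c≤n s≤n a*n<c*[1+s] =
  *-cancelˡ-≤ (c * c) (+-cancelʳ-≤ (4 * (c * c) * s + 2 * (c * c)) _ _ (begin
    c * c * (n * n + n) + (4 * (c * c) * s + 2 * (c * c)) ≡⟨ solve (c ∷ₗ n ∷ₗ s ∷ₗ []ₗ) ⟩
    c * c * (n * n) + (c * c * n + 4 * (c * c) * s + 2 * (c * c))
                                                      ≤⟨ +-monoʳ-≤ (c * c * (n * n)) lower-order ⟩
    c * c * (n * n) + n * n                           ≡⟨ solve (c ∷ₗ n ∷ₗ []ₗ) ⟩
    suc (c * c) * (n * n)                             ≤⟨ *-monoˡ-≤ (n * n) c*c<2*a*a ⟩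
    2 * (a * a) * (n * n)                             ≡⟨ solve (a ∷ₗ n ∷ₗ []ₗ) ⟩
    2 * ((a * n) * (a * n))                           ≤⟨ *-monoʳ-≤ 2 (*-mono-≤ a*n≤c*[1+s] a*n≤c*[1+s]) ⟩
    2 * ((c * suc s) * (c * suc s))                   ≡⟨ solve (c ∷ₗ s ∷ₗ []ₗ) ⟩
    c * c * (2 * (s * s)) + (4 * (c * c) * s + 2 * (c * c)) ∎))
  where
  open ≤-Reasoning
  instance
    c*c≢0 : NonZero (c * c)
    c*c≢0 = m*n≢0 c c
  a*n≤c*[1+s] : a * n ≤ c * suc s
  a*n≤c*[1+s] = <⇒≤ a*n<c*[1+s]
  lower-order : c * c * n + 4 * (c * c) * s + 2 * (c * c) ≤ n * n
  lower-order = begin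
    c * c * n + 4 * (c * c) * s + 2 * (c * c)     ≤⟨ +-mono-≤ (+-monoʳ-≤ (c * c * n) (*-monoʳ-≤ (4 * (c * c)) s≤n))
                                                               (m≤m*n (2 * (c * c)) n) ⟩
    c * c * n + 4 * (c * c) * n + 2 * (c * c) * n ≡⟨ solve (c ∷ₗ n ∷ₗ []ₗ) ⟩
    7 * (c * c) * n                               ≤⟨ *-monoˡ-≤ n 7*c*c≤n ⟩
    n * n                                         ∎

n≤1+2*⌊n/2⌋ : ∀ n → n ≤ suc (2 * ⌊ n /2⌋)
n≤1+2*⌊n/2⌋ zero          = z≤n
n≤1+2*⌊n/2⌋ (suc zero)    = s≤s z≤n
n≤1+2*⌊n/2⌋ (suc (suc n)) = begin
  suc (suc n)              ≤⟨ s≤s (s≤s (n≤1+2*⌊n/2⌋ n)) ⟩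
  suc (suc (suc (2 * k)))  ≡⟨ cong suc (*-suc 2 k) ⟨
  suc (2 * suc k)          ∎
  where
  open ≤-Reasoning
  k = ⌊ n /2⌋

n≤1+2*⌈n/2⌉ : ∀ n → n ≤ suc (2 * ⌈ n /2⌉)
n≤1+2*⌈n/2⌉ n = ≤-trans (n≤1+2*⌊n/2⌋ n) (s≤s (*-monoʳ-≤ 2 (⌊n/2⌋≤⌈n/2⌉ n)))

[1+p]*[1+p]+[1+p]≤2*[p*p] : ∀ p → 4 ≤ p → suc p * suc p + suc p ≤ 2 * (p * p)
[1+p]*[1+p]+[1+p]≤2*[p*p] p 4≤p = begin
  suc p * suc p + suc p ≡⟨ solve (p ∷ₗ []ₗ) ⟩
  p * p + (3 * p + 2)   ≤⟨ +-monoʳ-≤ (p * p) (+-monoʳ-≤ (3 * p) (≤-trans (s≤s (s≤s z≤n)) 4≤p)) ⟩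
  p * p + (3 * p + p)   ≡⟨ solve (p ∷ₗ []ₗ) ⟩
  p * p + 4 * p         ≤⟨ +-monoʳ-≤ (p * p) (*-monoˡ-≤ p 4≤p) ⟩
  p * p + p * p         ≡⟨ solve (p ∷ₗ []ₗ) ⟩
  2 * (p * p)           ∎
  where open ≤-Reasoning

∃-width : ∀ a b n → suc b * suc b < 2 * (a * a) → 7 * (suc b * suc b) ≤ n →
          ∃ λ s → s < n × n * n + n ≤ 2 * (s * s) × suc b * s ≤ a * n
∃-width a b n@(suc p) c*c<2*a*a 7*c*c≤n with n ≤? a * n / suc b
-- Not s = n: that leaves m = 0, and no pattern has values in Fin 0.
... | yes n≤q = p , ≤-refl , [1+p]*[1+p]+[1+p]≤2*[p*p] p 4≤p , (begin
  suc b * p             ≤⟨ *-monoʳ-≤ (suc b) (≤-trans (n≤1+n p) n≤q) ⟩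
  suc b * (a * n / suc b) ≤⟨ n*[m/n]≤m (a * n) (suc b) ⟩
  a * n                 ∎)
  where
  open ≤-Reasoning
  4≤p : 4 ≤ p
  4≤p = ≤-trans (m≤n+m 4 2) (≤-pred (≤-trans (m≤m*n 7 (suc b * suc b)) 7*c*c≤n))
... | no n≰q = q , q<n , n*n+n≤2*[s*s] a (suc b) n q c*c<2*a*a 7*c*c≤n (<⇒≤ q<n) (m<n*[1+m/n] (a * n) (suc b))
               , n*[m/n]≤m (a * n) (suc b)
  where
  q = a * n / suc b
  q<n : q < n
  q<n = ≰⇒> n≰q

rook-cover : ∀ n s → s < n → n * n + n ≤ 2 * (s * s) → aLe n (s * n)
rook-cover (suc zero)        zero    _         ()
rook-cover (suc zero)        (suc _) (s≤s ()) _
rook-cover (suc (suc _))     zero    _         ()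
rook-cover n@(suc (suc _)) s@(suc _) s<n square =
  Construction.covering m s ⌊ n /2⌋ ⌈ n /2⌉ m+s≡n (⌊n/2⌋+⌈n/2⌉≡n n)
    (CyclicPattern.cyclic-pattern s ⌊ n /2⌋ m (square⇒balanced m+s≡n square (n≤1+2*⌊n/2⌋ n)))
    (CyclicPattern.cyclic-pattern s ⌈ n /2⌉ m (square⇒balanced m+s≡n square (n≤1+2*⌈n/2⌉ n)))
  where
  m = n ∸ s
  m+s≡n : m + s ≡ n
  m+s≡n = m∸n+n≡m (<⇒≤ s<n)
  instance
    m≢0 : NonZero m
    m≢0 = >-nonZero (m<n⇒0<n∸m s<n)

theorem13 : (a b : ℕ) → suc b * suc b < 2 * (a * a) →
    ∃ λ N → (n : ℕ) → n ≥ N →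
      Σ ℕ λ k → aLe n k × suc b * k ≤ a * (n * n)
theorem13 a b c*c<2*a*a = 7 * (suc b * suc b) , covering
  where
  covering : (n : ℕ) → n ≥ 7 * (suc b * suc b) → Σ ℕ λ k → aLe n k × suc b * k ≤ a * (n * n)
  covering n 7*c*c≤n with ∃-width a b n c*c<2*a*a 7*c*c≤n
  ... | s , s<n , square , c*s≤a*n = s * n , rook-cover n s s<n square , (begin
    suc b * (s * n) ≡⟨ *-assoc (suc b) s n ⟨
    suc b * s * n   ≤⟨ *-monoˡ-≤ n c*s≤a*n ⟩
    a * n * n       ≡⟨ *-assoc a n n ⟩
    a * (n * n)     ∎)
    where open ≤-Reasoning
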